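{- For every typing context $\Gamma$, term $t$ and type $T$ of the $\lambda\Delta$-calculus: if $\Gamma \vdash t : T$, then $t \in [\![T]\!]_\Gamma$.
   Context: The $\lambda\Delta$-calculus. Types: $T ::= \perp \mid b \mid A \to B$, where $b$ ranges over base types and $\perp$ is absurdity; $\neg A$ abbreviates $A \to \perp$. Terms: $t ::= x \mid \lambda x{:}T.\,t \mid \Delta x{:}T.\,t \mid t_1\, t_2$, where $\lambda$ and $\Delta$ bind $x$; terms are taken up to renaming of bound variables. Normal forms: $n, m ::= x \mid \lambda x{:}T.\,n \mid \Delta x{:}T.\,n \mid h\, n$, with heads $h ::= x \mid h\, n$. Contexts $\Gamma$ are finite lists of assumptions $x{:}A$ with pairwise distinct variables (order irrelevant). Typing rules: (Ax) if $x{:}T \in \Gamma$ then $\Gamma \vdash x : T$; (Lam) if $\Gamma, x{:}A \vdash t : B$ then $\Gamma \vdash \lambda x{:}A.\,t : A \to B$; (App) if $\Gamma \vdash t_1 : A \to B$ and $\Gamma \vdash t_2 : A$ then $\Gamma \vdash t_1\, t_2 : B$; (Delta) if $\Gamma, x{:}\neg A \vdash t : \perp$ then $\Gamma \vdash \Delta x{:}\neg A.\,t : A$. Reduction $\to$ is the compatible closure of ($\beta$) $(\lambda x{:}A.\,t)\, t' \to [t'/x]t$ and (structural) $(\Delta x{:}\neg(A\to B).\,t)\, t' \to \Delta z{:}\neg B.\,[\lambda y{:}A\to B.\,(z\,(y\,t'))/x]\,t$ with $z, y$ fresh, where $[t'/x]t$ is capture-avoiding substitution. $\to^*$ is the reflexive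 transitive closure; $t \to^{!} t'$ means $t \to^* t'$ with $t'$ a normal form. Interpretation of types: for a normal form $n$, $n \in [\![T]\!]_\Gamma$ iff $\Gamma \vdash n : T$; for an arbitrary term $t$, $t \in [\![T]\!]_\Gamma$ iff there exists a normal form $n$ with $t \to^{!} n$ and $n \in [\![T]\!]_\Gamma$. -}

module Defs where

-- The λΔ-calculus, with terms in de Bruijn representation
-- (terms are taken up to renaming of bound variables).

open import Data.Nat using (ℕ; zero; suc)
open import Data.List using (List; []; _∷_)
open import Data.Product using (∃; _×_; _,_)
open import Relation.Binary.Construct.Closure.ReflexiveTransitive using (Star)

infixr 7 _⇒_

data Ty : Set where
  ⊥'   : Ty
  base : ℕ → Ty
  _⇒_  : Ty → Ty → Ty

¬' : Ty → Ty
¬' A = A ⇒ ⊥'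

infixl 8 _·_

data Tm : Set where
  var : ℕ → Tm
  lam : Ty → Tm → Tm
  del : Ty → Tm → Tm
  _·_ : Tm → Tm → Tm

ext : (ℕ → ℕ) → ℕ → ℕ
ext ρ zero    = zero
ext ρ (suc k) = suc (ρ k)

rename : (ℕ → ℕ) → Tm → Tm
rename ρ (var k)   = var (ρ k)
rename ρ (lam T t) = lam T (rename (ext ρ) t)
rename ρ (del T t) = del T (rename (ext ρ) t)
rename ρ (t · u)   = rename ρ t · rename ρ u

exts : (ℕ → Tm) → ℕ → Tm
exts σ zero    = var zero
exts σ (suc k) = rename suc (σ k)

subst : (ℕ → Tm) → Tm → Tm
subst σ (var k)   = σ k
subst σ (lam T t) = lam T (subst (exts σ) t)
subst σ (del T t) = del T (subst (exts σ) t)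
subst σ (t · u)   = subst σ t · subst σ u

sub0 : Tm → ℕ → Tm
sub0 u zero    = u
sub0 u (suc k) = var k

_[_] : Tm → Tm → Tm
t [ u ] = subst (sub0 u) t

-- replace variable 0 by u, keeping all other variables in place
-- (used when the bound x is replaced by a term mentioning the new binder z)
rep0 : Tm → ℕ → Tm
rep0 u zero    = u
rep0 u (suc k) = var (suc k)

-- Typing.  Contexts are lists of types (de Bruijn: index k refers to the
-- k-th entry, counting from the most recently bound).

Ctx : Set
Ctx = List Ty

data _∋_⦂_ : Ctx → ℕ → Ty → Set where
  here  : ∀ {Γ A} → (A ∷ Γ) ∋ zero ⦂ A
  there : ∀ {Γ A B k} → Γ ∋ k ⦂ A → (B ∷ Γ) ∋ suc k ⦂ A

infix 4 _⊢_⦂_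

data _⊢_⦂_ : Ctx → Tm → Ty → Set where
  ⊢var : ∀ {Γ k T} → Γ ∋ k ⦂ T → Γ ⊢ var k ⦂ T
  ⊢lam : ∀ {Γ A B t} → (A ∷ Γ) ⊢ t ⦂ B → Γ ⊢ lam A t ⦂ (A ⇒ B)
  ⊢app : ∀ {Γ A B t₁ t₂} → Γ ⊢ t₁ ⦂ (A ⇒ B) → Γ ⊢ t₂ ⦂ A → Γ ⊢ t₁ · t₂ ⦂ B
  ⊢del : ∀ {Γ A t} → (¬' A ∷ Γ) ⊢ t ⦂ ⊥' → Γ ⊢ del (¬' A) t ⦂ A

-- One-step reduction: compatible closure of β and the structural rule
--   (Δx:¬(A→B). t) t' → Δz:¬B. [λy:A→B. z (y t') / x] t

infix 4 _⟶_

data _⟶_ : Tm → Tm → Set where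
  β      : ∀ {A t u} → (lam A t) · u ⟶ t [ u ]
  struct : ∀ {A B t u} →
           del (¬' (A ⇒ B)) t · u ⟶
           del (¬' B)
             (subst (rep0 (lam (A ⇒ B)
                              (var 1 · (var 0 · rename (λ k → suc (suc k)) u))))
                    t)
  ξlam   : ∀ {T t t'} → t ⟶ t' → lam T t ⟶ lam T t'
  ξdel   : ∀ {T t t'} → t ⟶ t' → del T t ⟶ del T t'
  ξappₗ  : ∀ {t t' u} → t ⟶ t' → t · u ⟶ t' · u
  ξappᵣ  : ∀ {t u u'} → u ⟶ u' → t · u ⟶ t · u'

infix 4 _⟶*_

_⟶*_ : Tm → Tm → Set
_⟶*_ = Star _⟶_

data Normal : Tm → Set
data Head   : Tm → Set

data Normal where
  nvar : ∀ {k} → Normal (var k)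
  nlam : ∀ {T n} → Normal n → Normal (lam T n)
  ndel : ∀ {T n} → Normal n → Normal (del T n)
  napp : ∀ {h n} → Head h → Normal n → Normal (h · n)

data Head where
  hvar : ∀ {k} → Head (var k)
  happ : ∀ {h n} → Head h → Normal n → Head (h · n)

⟦_⟧_∋_ : Ty → Ctx → Tm → Set
⟦ T ⟧ Γ ∋ t = ∃ λ n → (t ⟶* n) × Normal n × (Γ ⊢ n ⦂ T)

module Submission where

-- The proof is by a Kripke logical relation  Red Γ A t : a term is reducible
-- when it normalises to a normal form of type A in Γ and, if A = B ⇒ C, its
-- renaming into any larger context applied to a reducible argument is
-- reducible.

open import Defs
open import Data.Nat using (ℕ; zero; suc)
open import Data.List using (_∷_)
open import Data.Product using (_×_; _,_; proj₁)
open import Data.Unit using (⊤; tt)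
open import Function using (_∘_; id)
open import Relation.Binary.Construct.Closure.ReflexiveTransitive using (ε; _◅_; _◅◅_; gmap)
open import Relation.Binary.PropositionalEquality
  using (_≡_; refl; sym; trans; cong; cong₂; module ≡-Reasoning)
  renaming (subst to transport)

-- 1. Renaming and substitution

exts-var : ∀ {σ : ℕ → Tm} {ρ : ℕ → ℕ} →
           (∀ j → σ j ≡ var (ρ j)) → ∀ j → exts σ j ≡ var (ext ρ j)
exts-var e zero    = refl
exts-var e (suc j) = cong (rename suc) (e j)

rename-as-subst : ∀ {σ : ℕ → Tm} {ρ : ℕ → ℕ} →
                  (∀ j → σ j ≡ var (ρ j)) → ∀ t → subst σ t ≡ rename ρ t
rename-as-subst e (var k)   = e k
rename-as-subst e (lam T t) = cong (lam T) (rename-as-subst (exts-var e) t)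
rename-as-subst e (del T t) = cong (del T) (rename-as-subst (exts-var e) t)
rename-as-subst e (t · u)   = cong₂ _·_ (rename-as-subst e t) (rename-as-subst e u)

exts-ext : ∀ {σ τ : ℕ → Tm} {ρ : ℕ → ℕ} →
           (∀ j → σ (ρ j) ≡ τ j) → ∀ j → exts σ (ext ρ j) ≡ exts τ j
exts-ext e zero    = refl
exts-ext e (suc j) = cong (rename suc) (e j)

subst-rename : ∀ {σ τ : ℕ → Tm} {ρ : ℕ → ℕ} →
               (∀ j → σ (ρ j) ≡ τ j) → ∀ t → subst σ (rename ρ t) ≡ subst τ t
subst-rename e (var k)   = e k
subst-rename e (lam T t) = cong (lam T) (subst-rename (exts-ext e) t)
subst-rename e (del T t) = cong (del T) (subst-rename (exts-ext e) t)
subst-rename e (t · u)   = cong₂ _·_ (subst-rename e t) (subst-rename e u)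

rename-∘ : ∀ (f g : ℕ → ℕ) t → rename f (rename g t) ≡ rename (f ∘ g) t
rename-∘ f g t = begin
  rename f (rename g t)         ≡⟨ sym (rename-as-subst (λ _ → refl) (rename g t)) ⟩
  subst (var ∘ f) (rename g t)  ≡⟨ subst-rename (λ _ → refl) t ⟩
  subst (var ∘ f ∘ g) t         ≡⟨ rename-as-subst (λ _ → refl) t ⟩
  rename (f ∘ g) t              ∎
  where open ≡-Reasoning

-- Renaming commutes with weakening: ext ρ ∘ suc and suc ∘ ρ coincide.
rename-ext-weaken : ∀ (ρ : ℕ → ℕ) t →
                    rename (ext ρ) (rename suc t) ≡ rename suc (rename ρ t)
rename-ext-weaken ρ t = trans (rename-∘ (ext ρ) suc t) (sym (rename-∘ suc ρ t))

ext-exts : ∀ {σ τ : ℕ → Tm} {ρ : ℕ → ℕ} →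
           (∀ j → rename ρ (σ j) ≡ τ j) → ∀ j → rename (ext ρ) (exts σ j) ≡ exts τ j
ext-exts e zero    = refl
ext-exts {σ} {ρ = ρ} e (suc j) = trans (rename-ext-weaken ρ (σ j)) (cong (rename suc) (e j))

rename-subst : ∀ {σ τ : ℕ → Tm} {ρ : ℕ → ℕ} →
               (∀ j → rename ρ (σ j) ≡ τ j) → ∀ t → rename ρ (subst σ t) ≡ subst τ t
rename-subst e (var k)   = e k
rename-subst e (lam T t) = cong (lam T) (rename-subst (ext-exts e) t)
rename-subst e (del T t) = cong (del T) (rename-subst (ext-exts e) t)
rename-subst e (t · u)   = cong₂ _·_ (rename-subst e t) (rename-subst e u)

exts-exts : ∀ {σ τ υ : ℕ → Tm} →
            (∀ j → subst τ (σ j) ≡ υ j) → ∀ j → subst (exts τ) (exts σ j) ≡ exts υ j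
exts-exts e zero = refl
exts-exts {σ} {τ} {υ} e (suc j) = begin
  subst (exts τ) (rename suc (σ j))  ≡⟨ subst-rename (λ _ → refl) (σ j) ⟩
  subst (rename suc ∘ τ) (σ j)       ≡⟨ sym (rename-subst (λ _ → refl) (σ j)) ⟩
  rename suc (subst τ (σ j))         ≡⟨ cong (rename suc) (e j) ⟩
  rename suc (υ j)                   ∎
  where open ≡-Reasoning

subst-subst : ∀ {σ τ υ : ℕ → Tm} →
              (∀ j → subst τ (σ j) ≡ υ j) → ∀ t → subst τ (subst σ t) ≡ subst υ t
subst-subst e (var k)   = e k
subst-subst e (lam T t) = cong (lam T) (subst-subst (exts-exts e) t)
subst-subst e (del T t) = cong (del T) (subst-subst (exts-exts e) t)
subst-subst e (t · u)   = cong₂ _·_ (subst-subst e t) (subst-subst e u)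

exts-id : ∀ {σ : ℕ → Tm} → (∀ j → σ j ≡ var j) → ∀ j → exts σ j ≡ var j
exts-id e zero    = refl
exts-id e (suc j) = cong (rename suc) (e j)

subst-id : ∀ {σ : ℕ → Tm} → (∀ j → σ j ≡ var j) → ∀ t → subst σ t ≡ t
subst-id e (var k)   = e k
subst-id e (lam T t) = cong (lam T) (subst-id (exts-id e) t)
subst-id e (del T t) = cong (del T) (subst-id (exts-id e) t)
subst-id e (t · u)   = cong₂ _·_ (subst-id e t) (subst-id e u)

rename-id : ∀ t → rename id t ≡ t
rename-id t = trans (sym (rename-as-subst (λ _ → refl) t)) (subst-id (λ _ → refl) t)

infixr 5 _•_

_•_ : Tm → (ℕ → Tm) → ℕ → Tm
(y • σ) zero    = y
(y • σ) (suc j) = σ j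

subst-•-weaken : ∀ y (ρ : ℕ → ℕ) t → subst (y • var ∘ ρ) (rename suc t) ≡ rename ρ t
subst-•-weaken y ρ t = trans (subst-rename (λ _ → refl) t) (rename-as-subst (λ _ → refl) t)

-- The continuation  λy:A. z (y u)  with which the structural rule replaces
-- the bound variable x, where z is the new binder (variable 0 outside the λ);
-- cont A u k is the same continuation with a term k in place of z.
structCont : Ty → Tm → Tm
structCont A u = lam A (var 1 · (var 0 · rename (suc ∘ suc) u))

cont : Ty → Tm → Tm → Tm
cont A u k = lam A (rename suc k · (var 0 · rename suc u))

subst-structCont : ∀ A u k (ρ : ℕ → ℕ) →
                   subst (k • var ∘ ρ) (structCont A u) ≡ cont A (rename ρ u) k
subst-structCont A u k ρ = cong (λ w → lam A (rename suc k · (var 0 · w))) (begin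
  subst (exts (k • var ∘ ρ)) (rename (suc ∘ suc) u) ≡⟨ subst-rename (λ _ → refl) u ⟩
  subst (var ∘ suc ∘ ρ) u                         ≡⟨ rename-as-subst (λ _ → refl) u ⟩
  rename (suc ∘ ρ) u                              ≡⟨ sym (rename-∘ suc ρ u) ⟩
  rename suc (rename ρ u)                         ∎)
  where open ≡-Reasoning

-- 2. Typed renamings

_⊆[_]_ : Ctx → (ℕ → ℕ) → Ctx → Set
Γ ⊆[ ρ ] Δ = ∀ {k A} → Γ ∋ k ⦂ A → Δ ∋ ρ k ⦂ A

⊆-ext : ∀ {Γ Δ ρ B} → Γ ⊆[ ρ ] Δ → (B ∷ Γ) ⊆[ ext ρ ] (B ∷ Δ)
⊆-ext ρ⊆ here      = here
⊆-ext ρ⊆ (there x) = there (ρ⊆ x)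

⊆-trans : ∀ {Γ Δ Θ ρ ρ'} → Γ ⊆[ ρ ] Δ → Δ ⊆[ ρ' ] Θ → Γ ⊆[ ρ' ∘ ρ ] Θ
⊆-trans ρ⊆ ρ'⊆ x = ρ'⊆ (ρ⊆ x)

rename-[] : ∀ (ρ : ℕ → ℕ) t u → rename ρ (t [ u ]) ≡ rename (ext ρ) t [ rename ρ u ]
rename-[] ρ t u = trans (rename-subst (λ _ → refl) t)
                        (sym (subst-rename (λ { zero → refl ; (suc _) → refl }) t))

rename-rep0 : ∀ (ρ : ℕ → ℕ) A t u →
              rename (ext ρ) (subst (rep0 (structCont A u)) t)
              ≡ subst (rep0 (structCont A (rename ρ u))) (rename (ext ρ) t)
rename-rep0 ρ A t u = trans (rename-subst (λ _ → refl) t) (sym (subst-rename cases t))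
  where
  cases : ∀ j → rep0 (structCont A (rename ρ u)) (ext ρ j)
                ≡ rename (ext ρ) (rep0 (structCont A u) j)
  cases zero    = cong (λ w → lam A (var 1 · (var 0 · w)))
                       (trans (rename-∘ (suc ∘ suc) ρ u) (sym (rename-∘ (ext (ext ρ)) (suc ∘ suc) u)))
  cases (suc j) = refl

⟶-rename : ∀ {t t'} (ρ : ℕ → ℕ) → t ⟶ t' → rename ρ t ⟶ rename ρ t'
⟶-rename ρ (β {A} {t} {u}) =
  transport (lam A (rename (ext ρ) t) · rename ρ u ⟶_) (sym (rename-[] ρ t u)) β
⟶-rename ρ (struct {A} {B} {t} {u}) =
  transport (λ w → del (¬' (A ⇒ B)) (rename (ext ρ) t) · rename ρ u ⟶ del (¬' B) w)
            (sym (rename-rep0 ρ (A ⇒ B) t u)) struct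
⟶-rename ρ (ξlam s)  = ξlam (⟶-rename (ext ρ) s)
⟶-rename ρ (ξdel s)  = ξdel (⟶-rename (ext ρ) s)
⟶-rename ρ (ξappₗ s) = ξappₗ (⟶-rename ρ s)
⟶-rename ρ (ξappᵣ s) = ξappᵣ (⟶-rename ρ s)

⟶*-rename : ∀ {t t'} (ρ : ℕ → ℕ) → t ⟶* t' → rename ρ t ⟶* rename ρ t'
⟶*-rename ρ = gmap (rename ρ) (⟶-rename ρ)

Normal-rename : ∀ {t} (ρ : ℕ → ℕ) → Normal t → Normal (rename ρ t)
Head-rename   : ∀ {t} (ρ : ℕ → ℕ) → Head t → Head (rename ρ t)
Normal-rename ρ nvar       = nvar
Normal-rename ρ (nlam n)   = nlam (Normal-rename (ext ρ) n)
Normal-rename ρ (ndel n)   = ndel (Normal-rename (ext ρ) n)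
Normal-rename ρ (napp h n) = napp (Head-rename ρ h) (Normal-rename ρ n)
Head-rename ρ hvar       = hvar
Head-rename ρ (happ h n) = happ (Head-rename ρ h) (Normal-rename ρ n)

⊢-rename : ∀ {Γ Δ ρ t A} → Γ ⊆[ ρ ] Δ → Γ ⊢ t ⦂ A → Δ ⊢ rename ρ t ⦂ A
⊢-rename ρ⊆ (⊢var x)   = ⊢var (ρ⊆ x)
⊢-rename ρ⊆ (⊢lam d)   = ⊢lam (⊢-rename (⊆-ext ρ⊆) d)
⊢-rename ρ⊆ (⊢app d e) = ⊢app (⊢-rename ρ⊆ d) (⊢-rename ρ⊆ e)
⊢-rename ρ⊆ (⊢del d)   = ⊢del (⊢-rename (⊆-ext ρ⊆) d)

⟦⟧-rename : ∀ {A Γ Δ ρ t} → Γ ⊆[ ρ ] Δ → ⟦ A ⟧ Γ ∋ t → ⟦ A ⟧ Δ ∋ rename ρ t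
⟦⟧-rename {ρ = ρ} ρ⊆ (n , t⟶n , N , d) =
  rename ρ n , ⟶*-rename ρ t⟶n , Normal-rename ρ N , ⊢-rename ρ⊆ d

⟦⟧-back : ∀ {A Γ t t'} → t ⟶* t' → ⟦ A ⟧ Γ ∋ t' → ⟦ A ⟧ Γ ∋ t
⟦⟧-back t⟶t' (n , t'⟶n , N , d) = n , t⟶t' ◅◅ t'⟶n , N , d

-- 3. Reducibility

Red    : Ctx → Ty → Tm → Set
Kripke : Ctx → Ty → Tm → Set

Red Γ A t = ⟦ A ⟧ Γ ∋ t × Kripke Γ A t

Kripke Γ (A ⇒ B) t = ∀ {Δ} ρ → Γ ⊆[ ρ ] Δ → ∀ u → Red Δ A u → Red Δ B (rename ρ t · u)
Kripke Γ _       t = ⊤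

Red-app : ∀ {Γ A B t u} → Red Γ (A ⇒ B) t → Red Γ A u → Red Γ B (t · u)
Red-app {Γ} {B = B} {t} {u} (_ , f) Ru =
  transport (λ s → Red Γ B (s · u)) (rename-id t) (f id id u Ru)

Red-rename : ∀ A {Γ Δ ρ} t → Γ ⊆[ ρ ] Δ → Red Γ A t → Red Δ A (rename ρ t)
Red-rename ⊥'       t ρ⊆ (w , _) = ⟦⟧-rename ρ⊆ w , tt
Red-rename (base _) t ρ⊆ (w , _) = ⟦⟧-rename ρ⊆ w , tt
Red-rename (A ⇒ B) {ρ = ρ} t ρ⊆ (w , f) = ⟦⟧-rename ρ⊆ w , λ ρ' ρ'⊆ u Ru →
  transport (λ s → Red _ B (s · u)) (sym (rename-∘ ρ' ρ t)) (f (ρ' ∘ ρ) (⊆-trans ρ⊆ ρ'⊆) u Ru)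

Red-back : ∀ A {Γ t t'} → t ⟶* t' → Red Γ A t' → Red Γ A t
Red-back ⊥'       t⟶t' (w , _) = ⟦⟧-back t⟶t' w , tt
Red-back (base _) t⟶t' (w , _) = ⟦⟧-back t⟶t' w , tt
Red-back (A ⇒ B)  t⟶t' (w , f) = ⟦⟧-back t⟶t' w , λ ρ ρ⊆ u Ru →
  Red-back B (gmap (_· u) ξappₗ (⟶*-rename ρ t⟶t')) (f ρ ρ⊆ u Ru)

Head-normal : ∀ {h} → Head h → Normal h
Head-normal hvar       = nvar
Head-normal (happ h n) = napp h n

-- Well-typed head terms (in particular variables) are reducible: applied to
-- a normalising argument they remain heads.
Red-head : ∀ A {Γ h} → Head h → Γ ⊢ h ⦂ A → Red Γ A h
Red-head ⊥'       H d = (_ , ε , Head-normal H , d) , tt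
Red-head (base _) H d = (_ , ε , Head-normal H , d) , tt
Red-head (A ⇒ B) {h = h} H d = (h , ε , Head-normal H , d) , λ ρ ρ⊆ u Ru →
  apply ρ ρ⊆ u (proj₁ Ru)
  where
  apply : ∀ {Δ} ρ → _ ⊆[ ρ ] Δ → ∀ u → ⟦ A ⟧ Δ ∋ u → Red Δ B (rename ρ h · u)
  apply ρ ρ⊆ u (n , u⟶n , N , dn) =
    Red-back B (gmap (rename ρ h ·_) ξappᵣ u⟶n)
      (Red-head B (happ (Head-rename ρ H) N) (⊢app (⊢-rename ρ⊆ d) dn))

-- 4. Semantic binders

SemBody : Ctx → Ty → Ty → Tm → Set
SemBody Δ A B b = ∀ {Θ} ρ → Δ ⊆[ ρ ] Θ → ∀ y → Red Θ A y → Red Θ B (subst (y • var ∘ ρ) b)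

-- Instantiating the bound variable by itself shows that the body normalises.
SemBody-⟦⟧ : ∀ {Δ A B b} → SemBody Δ A B b → ⟦ B ⟧ (A ∷ Δ) ∋ b
SemBody-⟦⟧ {A = A} {B} {b} H =
  transport (⟦ B ⟧ _ ∋_) (subst-id (λ { zero → refl ; (suc _) → refl }) b)
    (proj₁ (H suc there (var 0) (Red-head A hvar (⊢var here))))

SemBody-rename : ∀ {Δ Θ A B b} ρ → Δ ⊆[ ρ ] Θ → SemBody Δ A B b → SemBody Θ A B (rename (ext ρ) b)
SemBody-rename {B = B} {b} ρ ρ⊆ H ρ' ρ'⊆ y Ry =
  transport (Red _ B) (sym (subst-rename (λ { zero → refl ; (suc _) → refl }) b))
    (H (ρ' ∘ ρ) (⊆-trans ρ⊆ ρ'⊆) y Ry)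

Red-lam : ∀ {Δ A B} b → SemBody Δ A B b → Red Δ (A ⇒ B) (lam A b)
Red-lam {A = A} {B} b H = normalise (SemBody-⟦⟧ H) , λ ρ ρ⊆ u Ru →
  Red-back B (β ◅ ε)
    (transport (Red _ B) (sym (subst-rename (λ { zero → refl ; (suc _) → refl }) b)) (H ρ ρ⊆ u Ru))
  where
  normalise : ⟦ B ⟧ (A ∷ _) ∋ b → ⟦ A ⇒ B ⟧ _ ∋ lam A b
  normalise (n , b⟶n , N , d) = lam A n , gmap (lam A) ξlam b⟶n , nlam N , ⊢lam d

Red-cont : ∀ {Θ A B u k} → Red Θ A u → Red Θ (¬' B) k → Red Θ (¬' (A ⇒ B)) (cont (A ⇒ B) u k)
Red-cont {A = A} {B} {u} {k} Ru Rk = Red-lam _ λ ρ ρ⊆ y Ry →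
  transport (Red _ ⊥')
    (sym (cong₂ _·_ (subst-•-weaken y ρ k) (cong (y ·_) (subst-•-weaken y ρ u))))
    (Red-app (Red-rename (¬' B) k ρ⊆ Rk) (Red-app Ry (Red-rename A u ρ⊆ Ru)))

SemBody-struct : ∀ {Δ A B b u} → SemBody Δ (¬' (A ⇒ B)) ⊥' b → Red Δ A u →
                 SemBody Δ (¬' B) ⊥' (subst (rep0 (structCont (A ⇒ B) u)) b)
SemBody-struct {A = A} {B} {b} {u} H Ru ρ ρ⊆ k Rk =
  transport (Red _ ⊥') (sym (subst-subst cases b))
    (H ρ ρ⊆ (cont (A ⇒ B) (rename ρ u) k) (Red-cont (Red-rename A u ρ⊆ Ru) Rk))
  where
  cases : ∀ j → subst (k • var ∘ ρ) (rep0 (structCont (A ⇒ B) u) j)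
                ≡ (cont (A ⇒ B) (rename ρ u) k • var ∘ ρ) j
  cases zero    = subst-structCont (A ⇒ B) u k ρ
  cases (suc j) = refl

Red-del        : ∀ A {Δ} b → SemBody Δ (¬' A) ⊥' b → Red Δ A (del (¬' A) b)
Red-del-kripke : ∀ A {Δ} b → SemBody Δ (¬' A) ⊥' b → Kripke Δ A (del (¬' A) b)

Red-del A b H = normalise (SemBody-⟦⟧ H) , Red-del-kripke A b H
  where
  normalise : ⟦ ⊥' ⟧ (¬' A ∷ _) ∋ b → ⟦ A ⟧ _ ∋ del (¬' A) b
  normalise (n , b⟶n , N , d) = del (¬' A) n , gmap (del (¬' A)) ξdel b⟶n , ndel N , ⊢del d

-- At A ⇒ B the application reduces by the structural rule to a
-- Δ-abstraction at the smaller type B.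
Red-del-kripke ⊥'       b H = tt
Red-del-kripke (base _) b H = tt
Red-del-kripke (A ⇒ B)  b H ρ ρ⊆ u Ru =
  Red-back B (struct ◅ ε)
    (Red-del B _ (SemBody-struct {b = rename (ext ρ) b} (SemBody-rename {b = b} ρ ρ⊆ H) Ru))

-- 5. The fundamental lemma

RedEnv : Ctx → Ctx → (ℕ → Tm) → Set
RedEnv Γ Δ σ = ∀ {k A} → Γ ∋ k ⦂ A → Red Δ A (σ k)

RedEnv-id : ∀ {Γ} → RedEnv Γ Γ var
RedEnv-id {A = A} x = Red-head A hvar (⊢var x)

RedEnv-extend : ∀ {Γ Δ Θ σ ρ A y} → RedEnv Γ Δ σ → Δ ⊆[ ρ ] Θ → Red Θ A y →
                RedEnv (A ∷ Γ) Θ (y • rename ρ ∘ σ)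
RedEnv-extend env ρ⊆ Ry here = Ry
RedEnv-extend {σ = σ} env ρ⊆ Ry (there {A = A} {k = k} x) = Red-rename A (σ k) ρ⊆ (env x)

fundamental : ∀ {Γ t T} → Γ ⊢ t ⦂ T → ∀ {Δ σ} → RedEnv Γ Δ σ → Red Δ T (subst σ t)

fundamental-body : ∀ {Γ A B t} → (A ∷ Γ) ⊢ t ⦂ B → ∀ {Δ σ} → RedEnv Γ Δ σ →
                   SemBody Δ A B (subst (exts σ) t)
fundamental-body {B = B} {t} d {σ = σ} env ρ ρ⊆ y Ry =
  transport (Red _ B) (sym (subst-subst cases t)) (fundamental d (RedEnv-extend env ρ⊆ Ry))
  where
  cases : ∀ j → subst (y • var ∘ ρ) (exts σ j) ≡ (y • rename ρ ∘ σ) j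
  cases zero    = refl
  cases (suc j) = subst-•-weaken y ρ (σ j)

fundamental (⊢var x)        env = env x
fundamental (⊢app d e)      env = Red-app (fundamental d env) (fundamental e env)
fundamental (⊢lam d)        env = Red-lam _ (fundamental-body d env)
fundamental (⊢del {A = A} d) env = Red-del A _ (fundamental-body d env)

mainTheorem2 : ∀ (Γ : Ctx) (t : Tm) (T : Ty) → Γ ⊢ t ⦂ T → ⟦ T ⟧ Γ ∋ t
mainTheorem2 Γ t T d =
  transport (⟦ T ⟧ Γ ∋_) (subst-id (λ _ → refl) t) (proj₁ (fundamental d RedEnv-id))
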